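{- Let $\mathcal{A}$ be a d-class of subsets of a set $\Omega$. The difference of two dd sets (with respect to $\mathcal{A}$) is a ddd set.
   Context: A collection $\mathcal{A}$ of subsets of a set $\Omega$ is a d-class if it contains the empty set and, whenever $A,B\in\mathcal{A}$ have non-empty intersection, both $A\cap B$ and $A\cup B$ belong to $\mathcal{A}$; elements of $\mathcal{A}$ are called d sets. A dd set is a set of the form $A\setminus\bigsqcup_{i=1}^nA_i$ where $A,A_1,\dots,A_n$ are d sets with $A_i\subseteq A$ for each $i$ and the $A_i$ pairwise disjoint. A ddd set is a finite disjoint union of dd sets. -}

module Defs where

open import Level using (Level; _⊔_)
open import Data.Nat using (ℕ)
open import Data.Fin using (Fin)
open import Data.Product using (Σ; ∃; _×_)
open import Relation.Binary.PropositionalEquality using (_≢_)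
open import Relation.Unary using (Pred; _∈_; _⊆_; _≐_; _∩_; _∪_; _∖_; ⋃; ∅; _≬_; _⊥_)

private
  variable
    a ℓ ℓ' ℓ₀ : Level
    Ω : Set a

-- Since  Pred  is
-- intensional, "X belongs to 𝒜" for a *constructed* set X (∅, A ∩ B, A ∪ B)
-- is read up to extensional equality.
_∈ᶜ_ : Pred Ω ℓ₀ → Pred (Pred Ω ℓ) ℓ' → Set _
X ∈ᶜ 𝒜 = ∃ λ C → C ∈ 𝒜 × C ≐ X

record IsDClass {Ω : Set a} (𝒜 : Pred (Pred Ω ℓ) ℓ') : Set (a ⊔ Level.suc ℓ ⊔ ℓ') where
  field
    empty∈ : ∅ ∈ᶜ 𝒜
    ∩-closed : ∀ A B → A ∈ 𝒜 → B ∈ 𝒜 → A ≬ B → (A ∩ B) ∈ᶜ 𝒜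
    ∪-closed : ∀ A B → A ∈ 𝒜 → B ∈ 𝒜 → A ≬ B → (A ∪ B) ∈ᶜ 𝒜

PairwiseDisjoint : ∀ {n} → (Fin n → Pred Ω ℓ) → Set _
PairwiseDisjoint F = ∀ i j → i ≢ j → F i ⊥ F j

IsDD : {Ω : Set a} → Pred (Pred Ω ℓ) ℓ' → Pred Ω ℓ → Set _
IsDD {ℓ = ℓ} {Ω = Ω} 𝒜 D =
  Σ (Pred Ω ℓ) λ A → A ∈ 𝒜 ×
  Σ ℕ λ n → Σ (Fin n → Pred Ω ℓ) λ As →
    (∀ i → As i ∈ 𝒜) × (∀ i → As i ⊆ A) × PairwiseDisjoint As ×
    (D ≐ (A ∖ ⋃ (Fin n) As))

IsDDD : {Ω : Set a} → Pred (Pred Ω ℓ) ℓ' → Pred Ω ℓ → Set _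
IsDDD {ℓ = ℓ} {Ω = Ω} 𝒜 D =
  Σ ℕ λ m → Σ (Fin m → Pred Ω ℓ) λ Ds →
    (∀ k → IsDD 𝒜 (Ds k)) × PairwiseDisjoint Ds × (D ≐ ⋃ (Fin m) Ds)

{-# OPTIONS --safe #-}
-- Write D₁ = A ∖ ⨆ Aᵢ and D₂ = B ∖ ⨆ Bⱼ. Then D₁ ∖ D₂ is the disjoint union
-- of D₁ ∖ B and the sets D₁ ∩ Bⱼ, so it suffices that a dd set stays dd when
-- intersected with, or reduced by, a d set B. The intersection is
-- (A ∩ B) ∖ ⨆ (Aᵢ ∩ B). For the difference put C = A ∩ B and glue onto C all
-- the Aᵢ that meet C: every glued piece meets C, so the union U stays a d set,
-- and D₁ ∖ B = A ∖ (U ⊔ ⨆ {Aᵢ : Aᵢ ∩ C = ∅}). Excluded middle decides which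
-- sets meet.
module Submission where

open import Defs
open import Level using (Level; _⊔_; Lift; lift; lower)
open import Axiom.ExcludedMiddle using (ExcludedMiddle)
open import Data.Nat using (zero; suc)
open import Data.Fin using (Fin; zero; suc; _≟_)
open import Data.Product using (_,_; proj₁; proj₂)
open import Data.Sum using (_⊎_; inj₁; inj₂)
open import Data.Empty using (⊥; ⊥-elim)
open import Function using (_∘_)
open import Relation.Nullary using (Dec; yes; no; ¬_; ¬?)
open import Relation.Nullary.Decidable using (map′)
open import Relation.Binary.PropositionalEquality using (refl; cong)
open import Relation.Unary using (Pred; _∖_; _∈_; _⊆_; _≐_; _∩_; _∪_; ⋃; _≬_; _∉_; Empty)
open import Relation.Unary.Polymorphic using (∅)
open import Relation.Unary.Properties using (≐-refl; ≐-trans)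
open import Relation.Unary.Algebra using (∪-cong)

lowerExcludedMiddle : ∀ {ℓ₁} ℓ₂ → ExcludedMiddle (ℓ₁ ⊔ ℓ₂) → ExcludedMiddle ℓ₁
lowerExcludedMiddle ℓ₂ em = map′ lower lift (em {Lift ℓ₂ _})

keepIf : ∀ {a ℓ p} {Ω : Set a} {P : Set p} → Dec P → Pred Ω ℓ → Pred Ω ℓ
keepIf (yes _) X = X
keepIf (no _)  X = ∅

module _ {a ℓ p : Level} {Ω : Set a} {P : Set p} where

  keepIf-⊆ : ∀ (d : Dec P) {X : Pred Ω ℓ} → keepIf d X ⊆ X
  keepIf-⊆ (yes _) x∈X = x∈X

  keepIf-split : ∀ (d : Dec P) {X : Pred Ω ℓ} → X ⊆ keepIf d X ∪ keepIf (¬? d) X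
  keepIf-split (yes _) x∈X = inj₁ x∈X
  keepIf-split (no _)  x∈X = inj₂ x∈X

module _ {a ℓ ℓ' : Level} {Ω : Set a} {𝒜 : Pred (Pred Ω ℓ) ℓ'} where

  ∈ᶜ-resp-≐ : ∀ {X Y : Pred Ω ℓ} → X ≐ Y → X ∈ᶜ 𝒜 → Y ∈ᶜ 𝒜
  ∈ᶜ-resp-≐ X≐Y (C , C∈ , C≐X) = C , C∈ , ≐-trans C≐X X≐Y

  ∈⇒∈ᶜ : ∀ {X : Pred Ω ℓ} → X ∈ 𝒜 → X ∈ᶜ 𝒜
  ∈⇒∈ᶜ {X} X∈ = X , X∈ , ≐-refl

  isDD-fromᶜ : ∀ {A D : Pred Ω ℓ} {n} {As : Fin n → Pred Ω ℓ} →
    A ∈ᶜ 𝒜 → (∀ i → As i ∈ᶜ 𝒜) → (∀ i → As i ⊆ A) → PairwiseDisjoint As →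
    D ≐ A ∖ ⋃ (Fin n) As → IsDD 𝒜 D
  isDD-fromᶜ {D = D} {n = n} {As = As} (A′ , A′∈ , A′⊆A , A⊆A′) As∈ As⊆A disjoint (D⊆ , D⊇) =
    A′ , A′∈ , n , As′ , (proj₁ ∘ proj₂ ∘ As∈) , As′⊆A′ , disjoint′ , D⊆′ , D⊇′
    where
      As′ : Fin n → Pred Ω ℓ
      As′ = proj₁ ∘ As∈
      As′⊆As : ∀ i → As′ i ⊆ As i
      As′⊆As i = proj₁ (proj₂ (proj₂ (As∈ i)))
      As⊆As′ : ∀ i → As i ⊆ As′ i
      As⊆As′ i = proj₂ (proj₂ (proj₂ (As∈ i)))
      As′⊆A′ : ∀ i → As′ i ⊆ A′
      As′⊆A′ i = A⊆A′ ∘ As⊆A i ∘ As′⊆As i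
      disjoint′ : PairwiseDisjoint As′
      disjoint′ i j i≢j (x∈i , x∈j) = disjoint i j i≢j (As′⊆As i x∈i , As′⊆As j x∈j)
      D⊆′ : D ⊆ A′ ∖ ⋃ (Fin n) As′
      D⊆′ x∈D = let (x∈A , x∉⋃) = D⊆ x∈D in
        A⊆A′ x∈A , λ (i , x∈i) → x∉⋃ (i , As′⊆As i x∈i)
      D⊇′ : A′ ∖ ⋃ (Fin n) As′ ⊆ D
      D⊇′ (x∈A′ , x∉⋃) = D⊇ (A′⊆A x∈A′ , λ (i , x∈i) → x∉⋃ (i , As⊆As′ i x∈i))

module DClass {a ℓ ℓ' : Level} {Ω : Set a} {𝒜 : Pred (Pred Ω ℓ) ℓ'} (dc : IsDClass 𝒜) where

  open IsDClass dc

  empty-∈ᶜ : ∀ {X : Pred Ω ℓ} → Empty X → X ∈ᶜ 𝒜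
  empty-∈ᶜ X-empty =
    let (E , E∈ , E⊆∅ , _) = empty∈ in
    E , E∈ , (λ x∈E → ⊥-elim (E⊆∅ x∈E)) , (λ {x} x∈X → ⊥-elim (X-empty x x∈X))

  keepIf-∈ᶜ : ∀ {p} {P : Set p} (d : Dec P) {X : Pred Ω ℓ} → X ∈ 𝒜 → keepIf d X ∈ᶜ 𝒜
  keepIf-∈ᶜ (yes _) X∈ = ∈⇒∈ᶜ X∈
  keepIf-∈ᶜ (no _)  _  = empty-∈ᶜ (λ _ ())

  ∪-closedᶜ : ∀ {X Y : Pred Ω ℓ} → X ∈ᶜ 𝒜 → Y ∈ᶜ 𝒜 → X ≬ Y → (X ∪ Y) ∈ᶜ 𝒜
  ∪-closedᶜ (X′ , X′∈ , X′≐X) (Y′ , Y′∈ , Y′≐Y) (x , x∈X , x∈Y) =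
    ∈ᶜ-resp-≐ (∪-cong X′≐X Y′≐Y)
      (∪-closed X′ Y′ X′∈ Y′∈ (x , proj₂ X′≐X x∈X , proj₂ Y′≐Y x∈Y))

  ∪-absorbᶜ : ∀ {n} {C : Pred Ω ℓ} (Ms : Fin n → Pred Ω ℓ) → C ∈ᶜ 𝒜 →
    (∀ i → Ms i ∈ᶜ 𝒜) → (∀ i → Ms i ≬ C ⊎ Empty (Ms i)) → (C ∪ ⋃ (Fin n) Ms) ∈ᶜ 𝒜
  ∪-absorbᶜ {zero} Ms C∈ _ _ = ∈ᶜ-resp-≐ (inj₁ , λ { (inj₁ x∈C) → x∈C ; (inj₂ (() , _)) }) C∈
  ∪-absorbᶜ {suc n} {C} Ms C∈ Ms∈ meets-or-empty
    with ∪-absorbᶜ (Ms ∘ suc) C∈ (Ms∈ ∘ suc) (meets-or-empty ∘ suc) | meets-or-empty zero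
  ... | U∈ | inj₁ (x , x∈M₀ , x∈C) =
    ∈ᶜ-resp-≐ (grow , shrink) (∪-closedᶜ U∈ (Ms∈ zero) (x , inj₁ x∈C , x∈M₀))
    where
      grow : (C ∪ ⋃ (Fin n) (Ms ∘ suc)) ∪ Ms zero ⊆ C ∪ ⋃ (Fin (suc n)) Ms
      grow (inj₁ (inj₁ x∈C))       = inj₁ x∈C
      grow (inj₁ (inj₂ (i , x∈M))) = inj₂ (suc i , x∈M)
      grow (inj₂ x∈M₀)             = inj₂ (zero , x∈M₀)
      shrink : C ∪ ⋃ (Fin (suc n)) Ms ⊆ (C ∪ ⋃ (Fin n) (Ms ∘ suc)) ∪ Ms zero
      shrink (inj₁ x∈C)           = inj₁ (inj₁ x∈C)
      shrink (inj₂ (zero , x∈M₀)) = inj₂ x∈M₀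
      shrink (inj₂ (suc i , x∈M)) = inj₁ (inj₂ (i , x∈M))
  ... | U∈ | inj₂ M₀-empty = ∈ᶜ-resp-≐ (grow , shrink) U∈
    where
      grow : C ∪ ⋃ (Fin n) (Ms ∘ suc) ⊆ C ∪ ⋃ (Fin (suc n)) Ms
      grow (inj₁ x∈C)       = inj₁ x∈C
      grow (inj₂ (i , x∈M)) = inj₂ (suc i , x∈M)
      shrink : C ∪ ⋃ (Fin (suc n)) Ms ⊆ C ∪ ⋃ (Fin n) (Ms ∘ suc)
      shrink (inj₁ x∈C)               = inj₁ x∈C
      shrink {x} (inj₂ (zero , x∈M₀)) = ⊥-elim (M₀-empty x x∈M₀)
      shrink (inj₂ (suc i , x∈M))     = inj₂ (i , x∈M)

  module _ (em : ExcludedMiddle (a ⊔ ℓ)) where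

    ∩-closed-total : ∀ {X Y : Pred Ω ℓ} → X ∈ 𝒜 → Y ∈ 𝒜 → (X ∩ Y) ∈ᶜ 𝒜
    ∩-closed-total {X} {Y} X∈ Y∈ with em {X ≬ Y}
    ... | yes X≬Y = ∩-closed X Y X∈ Y∈ X≬Y
    ... | no X⊥Y  = empty-∈ᶜ (λ x (x∈X , x∈Y) → X⊥Y (x , x∈X , x∈Y))

    isDD-∩ : ∀ {D B : Pred Ω ℓ} → IsDD 𝒜 D → B ∈ 𝒜 → IsDD 𝒜 (D ∩ B)
    isDD-∩ {D} {B} (A , A∈ , n , As , As∈ , As⊆A , disjoint , D⊆ , D⊇) B∈ =
      isDD-fromᶜ (∩-closed-total A∈ B∈) (λ i → ∩-closed-total (As∈ i) B∈)
        (λ i (x∈Aᵢ , x∈B) → As⊆A i x∈Aᵢ , x∈B)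
        (λ i j i≢j ((x∈Aᵢ , _) , (x∈Aⱼ , _)) → disjoint i j i≢j (x∈Aᵢ , x∈Aⱼ))
        (⊆-lhs , ⊆-rhs)
      where
        ⊆-lhs : D ∩ B ⊆ (A ∩ B) ∖ ⋃ (Fin n) (λ i → As i ∩ B)
        ⊆-lhs (x∈D , x∈B) = let (x∈A , x∉⋃) = D⊆ x∈D in
          (x∈A , x∈B) , λ (i , x∈Aᵢ , _) → x∉⋃ (i , x∈Aᵢ)
        ⊆-rhs : (A ∩ B) ∖ ⋃ (Fin n) (λ i → As i ∩ B) ⊆ D ∩ B
        ⊆-rhs ((x∈A , x∈B) , x∉⋃) = D⊇ (x∈A , λ (i , x∈Aᵢ) → x∉⋃ (i , x∈Aᵢ , x∈B)) , x∈B

    isDD-∖ : ∀ {D B : Pred Ω ℓ} → IsDD 𝒜 D → B ∈ 𝒜 → IsDD 𝒜 (D ∖ B)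
    isDD-∖ {D} {B} (A , A∈ , n , As , As∈ , As⊆A , disjoint , D⊆ , D⊇) B∈ =
      isDD-fromᶜ (∈⇒∈ᶜ A∈) Hs∈ Hs⊆A Hs-disjoint (⊆-lhs , ⊆-rhs)
      where
        C : Pred Ω ℓ
        C = A ∩ B
        meets? : ∀ i → Dec (As i ≬ C)
        meets? i = em
        Ms Gs : Fin n → Pred Ω ℓ
        Ms i = keepIf (meets? i) (As i)
        Gs i = keepIf (¬? (meets? i)) (As i)
        Hs : Fin (suc n) → Pred Ω ℓ
        Hs zero    = C ∪ ⋃ (Fin n) Ms
        Hs (suc i) = Gs i

        Ms-meets-or-empty : ∀ i → Ms i ≬ C ⊎ Empty (Ms i)
        Ms-meets-or-empty i with meets? i
        ... | yes Aᵢ≬C = inj₁ Aᵢ≬C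
        ... | no _     = inj₂ (λ _ ())

        Ms-meets : ∀ i {x} → x ∈ Ms i → As i ≬ C
        Ms-meets i with meets? i
        ... | yes Aᵢ≬C = λ _ → Aᵢ≬C

        Gs-⊥C : ∀ j {x} → x ∈ Gs j → ¬ (As j ≬ C)
        Gs-⊥C j with meets? j
        ... | no Aⱼ⊥C = λ _ → Aⱼ⊥C

        Hs∈ : ∀ i → Hs i ∈ᶜ 𝒜
        Hs∈ zero    = ∪-absorbᶜ Ms (∩-closed-total A∈ B∈)
                        (λ i → keepIf-∈ᶜ (meets? i) (As∈ i)) Ms-meets-or-empty
        Hs∈ (suc i) = keepIf-∈ᶜ (¬? (meets? i)) (As∈ i)

        Hs⊆A : ∀ i → Hs i ⊆ A
        Hs⊆A zero (inj₁ (x∈A , _))  = x∈A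
        Hs⊆A zero (inj₂ (i , x∈Mᵢ)) = As⊆A i (keepIf-⊆ (meets? i) x∈Mᵢ)
        Hs⊆A (suc i) x∈Gᵢ           = As⊆A i (keepIf-⊆ (¬? (meets? i)) x∈Gᵢ)

        Gs⊥Hs₀ : ∀ j {x} → x ∈ Gs j → x ∈ Hs zero → ⊥
        Gs⊥Hs₀ j {x} x∈Gⱼ (inj₁ x∈C) =
          Gs-⊥C j x∈Gⱼ (x , keepIf-⊆ (¬? (meets? j)) x∈Gⱼ , x∈C)
        Gs⊥Hs₀ j x∈Gⱼ (inj₂ (i , x∈Mᵢ)) with i ≟ j
        ... | yes refl = Gs-⊥C j x∈Gⱼ (Ms-meets j x∈Mᵢ)
        ... | no i≢j   =
          disjoint i j i≢j (keepIf-⊆ (meets? i) x∈Mᵢ , keepIf-⊆ (¬? (meets? j)) x∈Gⱼ)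

        Hs-disjoint : PairwiseDisjoint Hs
        Hs-disjoint zero    zero    0≢0 _             = 0≢0 refl
        Hs-disjoint zero    (suc j) _   (x∈H₀ , x∈Gⱼ) = Gs⊥Hs₀ j x∈Gⱼ x∈H₀
        Hs-disjoint (suc i) zero    _   (x∈Gᵢ , x∈H₀) = Gs⊥Hs₀ i x∈Gᵢ x∈H₀
        Hs-disjoint (suc i) (suc j) i≢j (x∈Gᵢ , x∈Gⱼ) =
          disjoint i j (i≢j ∘ cong suc)
            (keepIf-⊆ (¬? (meets? i)) x∈Gᵢ , keepIf-⊆ (¬? (meets? j)) x∈Gⱼ)

        As⊆⋃Hs : ∀ i → As i ⊆ ⋃ (Fin (suc n)) Hs
        As⊆⋃Hs i x∈Aᵢ with keepIf-split (meets? i) x∈Aᵢ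
        ... | inj₁ x∈Mᵢ = zero , inj₂ (i , x∈Mᵢ)
        ... | inj₂ x∈Gᵢ = suc i , x∈Gᵢ

        ⊆-lhs : D ∖ B ⊆ A ∖ ⋃ (Fin (suc n)) Hs
        ⊆-lhs {x} (x∈D , x∉B) = proj₁ (D⊆ x∈D) , x∉⋃Hs
          where
            x∉⋃As : x ∉ ⋃ (Fin n) As
            x∉⋃As = proj₂ (D⊆ x∈D)
            x∉⋃Hs : x ∉ ⋃ (Fin (suc n)) Hs
            x∉⋃Hs (zero , inj₁ (_ , x∈B))  = x∉B x∈B
            x∉⋃Hs (zero , inj₂ (i , x∈Mᵢ)) = x∉⋃As (i , keepIf-⊆ (meets? i) x∈Mᵢ)
            x∉⋃Hs (suc i , x∈Gᵢ)           = x∉⋃As (i , keepIf-⊆ (¬? (meets? i)) x∈Gᵢ)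

        ⊆-rhs : A ∖ ⋃ (Fin (suc n)) Hs ⊆ D ∖ B
        ⊆-rhs (x∈A , x∉⋃Hs) =
          D⊇ (x∈A , λ (i , x∈Aᵢ) → x∉⋃Hs (As⊆⋃Hs i x∈Aᵢ)) ,
          λ x∈B → x∉⋃Hs (zero , inj₁ (x∈A , x∈B))

    isDDD-∖ : ∀ {D₁ D₂ : Pred Ω ℓ} → IsDD 𝒜 D₁ → IsDD 𝒜 D₂ → IsDDD 𝒜 (D₁ ∖ D₂)
    isDDD-∖ {D₁} {D₂} D₁-dd (B , B∈ , m , Bs , Bs∈ , Bs⊆B , disjoint , D₂⊆ , D₂⊇) =
      suc m , Pieces , Pieces-dd , Pieces-disjoint , ⊆-lhs , ⊆-rhs
      where
        Pieces : Fin (suc m) → Pred Ω ℓ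
        Pieces zero    = D₁ ∖ B
        Pieces (suc j) = D₁ ∩ Bs j

        Pieces-dd : ∀ k → IsDD 𝒜 (Pieces k)
        Pieces-dd zero    = isDD-∖ D₁-dd B∈
        Pieces-dd (suc j) = isDD-∩ D₁-dd (Bs∈ j)

        Pieces-disjoint : PairwiseDisjoint Pieces
        Pieces-disjoint zero    zero    0≢0 _                          = 0≢0 refl
        Pieces-disjoint zero    (suc j) _   ((_ , x∉B) , (_ , x∈Bⱼ))   = x∉B (Bs⊆B j x∈Bⱼ)
        Pieces-disjoint (suc i) zero    _   ((_ , x∈Bᵢ) , (_ , x∉B))   = x∉B (Bs⊆B i x∈Bᵢ)
        Pieces-disjoint (suc i) (suc j) i≢j ((_ , x∈Bᵢ) , (_ , x∈Bⱼ)) =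
          disjoint i j (i≢j ∘ cong suc) (x∈Bᵢ , x∈Bⱼ)

        dec : ExcludedMiddle ℓ
        dec = lowerExcludedMiddle a em

        ⊆-lhs : D₁ ∖ D₂ ⊆ ⋃ (Fin (suc m)) Pieces
        ⊆-lhs {x} (x∈D₁ , x∉D₂) with dec {B x}
        ... | no x∉B = zero , x∈D₁ , x∉B
        ... | yes x∈B with dec {⋃ (Fin m) Bs x}
        ...   | yes (j , x∈Bⱼ) = suc j , x∈D₁ , x∈Bⱼ
        ...   | no x∉⋃Bs       = ⊥-elim (x∉D₂ (D₂⊇ (x∈B , x∉⋃Bs)))

        ⊆-rhs : ⋃ (Fin (suc m)) Pieces ⊆ D₁ ∖ D₂
        ⊆-rhs (zero , x∈D₁ , x∉B)    = x∈D₁ , λ x∈D₂ → x∉B (proj₁ (D₂⊆ x∈D₂))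
        ⊆-rhs (suc j , x∈D₁ , x∈Bⱼ) = x∈D₁ , λ x∈D₂ → proj₂ (D₂⊆ x∈D₂) (j , x∈Bⱼ)

mainTheorem18 : {a ℓ ℓ' : Level} → ExcludedMiddle (a ⊔ ℓ ⊔ ℓ') →
    (Ω : Set a) (𝒜 : Pred (Pred Ω ℓ) ℓ') → IsDClass 𝒜 →
    (D₁ D₂ : Pred Ω ℓ) → IsDD 𝒜 D₁ → IsDD 𝒜 D₂ → IsDDD 𝒜 (D₁ ∖ D₂)
mainTheorem18 {ℓ' = ℓ'} em Ω 𝒜 dc D₁ D₂ =
  DClass.isDDD-∖ dc (lowerExcludedMiddle ℓ' em)
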